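{- Let $G_1,G_2$ be finite simple graphs with disjoint nonempty vertex sets, $|V(G_1)|\le|V(G_2)|$, and let $p$ be the number of connected components of $G_2$. Then $\mathrm{hn}_{cc}(G_1\vee G_2)=\mathrm{hn}_{cc}(G_1)+\mathrm{hn}_{cc}(G_2)$, and $$\mathrm{hn}_{cc}(G_1\wedge G_2)=\begin{cases}p+1,& \text{if } |V(G_1)|=1;\\ 2,& \text{if } |V(G_1)|>1 \text{ and } E(G_i)\neq\emptyset \text{ for some } i\in\{1,2\};\\ 3,& \text{otherwise.}\end{cases}$$
   Context: $G_1\vee G_2$ is the (disjoint) union, with vertex set $V(G_1)\cup V(G_2)$ and edge set $E(G_1)\cup E(G_2)$; $G_1\wedge G_2$ (the join) is obtained from $G_1\vee G_2$ by adding all edges with one endpoint in $V(G_1)$ and the other in $V(G_2)$. A cycle is a closed walk $(v_1,\dots,v_q,v_1)$ with at least one edge in which the only repeated vertex is $v_1$. For $S\subseteq V(G)$, $I_{cc}(S)=S\cup\{x\in V(G): \text{there is a cycle } C \text{ of } G \text{ with } V(C)\setminus S=\{x\}\}$. A set $X$ is convex if $I_{cc}(X)=X$; $\mathrm{hull}(X)$ is the smallest convex set containing $X$; $X$ is a hull set if $\mathrm{hull}(X)=V(G)$; $\mathrm{hn}_{cc}(G)$ is the minimum cardinality of a hull set. -}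

module Defs where

open import Data.Nat using (ℕ; zero; suc; _+_; _≤_)
open import Data.Bool using (Bool; true; false)
open import Data.Fin using (Fin; zero; suc; inject₁; fromℕ; splitAt)
open import Data.Fin.Subset using (Subset; _∈_; _∉_; _⊆_; ∣_∣)
open import Data.Sum using (_⊎_; inj₁; inj₂)
open import Data.Product using (Σ; _×_; _,_; ∃)
open import Relation.Binary.PropositionalEquality using (_≡_)
open import Relation.Nullary using (¬_)
open import Function.Definitions using (Injective; Surjective)

record Graph (n : ℕ) : Set where
  constructor mkGraph
  field
    adj : Fin n → Fin n → Bool
open Graph public

record IsSimple {n : ℕ} (G : Graph n) : Set where
  field
    symm    : ∀ u v → adj G u v ≡ adj G v u
    irrefl  : ∀ v → adj G v v ≡ false

NoEdges : {n : ℕ} → Graph n → Set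
NoEdges G = ∀ u v → adj G u v ≡ false

-- Disjoint union G₁ ∨ G₂ on vertex set Fin (n₁ + n₂):
-- the first n₁ vertices are V(G₁), the remaining n₂ are V(G₂).
unionAdj : {n₁ n₂ : ℕ} → Graph n₁ → Graph n₂ → Fin n₁ ⊎ Fin n₂ → Fin n₁ ⊎ Fin n₂ → Bool
unionAdj G₁ G₂ (inj₁ a) (inj₁ b) = adj G₁ a b
unionAdj G₁ G₂ (inj₂ a) (inj₂ b) = adj G₂ a b
unionAdj G₁ G₂ (inj₁ a) (inj₂ b) = false
unionAdj G₁ G₂ (inj₂ a) (inj₁ b) = false

_∨ᴳ_ : {n₁ n₂ : ℕ} → Graph n₁ → Graph n₂ → Graph (n₁ + n₂)
_∨ᴳ_ {n₁} G₁ G₂ = mkGraph (λ u v → unionAdj G₁ G₂ (splitAt n₁ u) (splitAt n₁ v))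

-- Join G₁ ∧ G₂: the union plus all edges between V(G₁) and V(G₂).
joinAdj : {n₁ n₂ : ℕ} → Graph n₁ → Graph n₂ → Fin n₁ ⊎ Fin n₂ → Fin n₁ ⊎ Fin n₂ → Bool
joinAdj G₁ G₂ (inj₁ a) (inj₁ b) = adj G₁ a b
joinAdj G₁ G₂ (inj₂ a) (inj₂ b) = adj G₂ a b
joinAdj G₁ G₂ (inj₁ a) (inj₂ b) = true
joinAdj G₁ G₂ (inj₂ a) (inj₁ b) = true

_∧ᴳ_ : {n₁ n₂ : ℕ} → Graph n₁ → Graph n₂ → Graph (n₁ + n₂)
_∧ᴳ_ {n₁} G₁ G₂ = mkGraph (λ u v → joinAdj G₁ G₂ (splitAt n₁ u) (splitAt n₁ v))

-- A cycle (v₁, …, v_q, v₁): q ≥ 3 pairwise distinct vertices (indexed by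
-- Fin (3 + m)), consecutive ones adjacent, and v_q adjacent to v₁.
record Cycle {n : ℕ} (G : Graph n) : Set where
  field
    m      : ℕ
    vs     : Fin (suc (suc (suc m))) → Fin n
    inj    : Injective _≡_ _≡_ vs
    step   : ∀ (i : Fin (suc (suc m))) → adj G (vs (inject₁ i)) (vs (suc i)) ≡ true
    close  : adj G (vs (fromℕ (suc (suc m)))) (vs zero) ≡ true
open Cycle public

OnCycle : {n : ℕ} {G : Graph n} → Cycle G → Fin n → Set
OnCycle C x = ∃ λ i → vs C i ≡ x

CycleMinus≡ : {n : ℕ} {G : Graph n} → Cycle G → Subset n → Fin n → Set
CycleMinus≡ C S x = OnCycle C x × x ∉ S × (∀ i → vs C i ∉ S → vs C i ≡ x)

InIcc : {n : ℕ} → Graph n → Subset n → Fin n → Set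
InIcc G S x = x ∈ S ⊎ Σ (Cycle G) (λ C → CycleMinus≡ C S x)

-- X convex : I_cc(X) = X  (X ⊆ I_cc(X) always holds)
Convex : {n : ℕ} → Graph n → Subset n → Set
Convex G X = ∀ x → InIcc G X x → x ∈ X

InHull : {n : ℕ} → Graph n → Subset n → Fin n → Set
InHull {n} G X x = ∀ (Y : Subset n) → Convex G Y → X ⊆ Y → x ∈ Y

IsHullSet : {n : ℕ} → Graph n → Subset n → Set
IsHullSet G X = ∀ x → InHull G X x

IsHullNumber : {n : ℕ} → Graph n → ℕ → Set
IsHullNumber {n} G k =
  (Σ (Subset n) λ X → IsHullSet G X × ∣ X ∣ ≡ k) ×
  (∀ (X : Subset n) → IsHullSet G X → k ≤ ∣ X ∣)

data Reach {n : ℕ} (G : Graph n) : Fin n → Fin n → Set where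
  here : ∀ {u} → Reach G u u
  there : ∀ {u v w} → adj G u v ≡ true → Reach G v w → Reach G u w

NumComponents : {n : ℕ} → Graph n → ℕ → Set
NumComponents {n} G p =
  Σ (Fin n → Fin p) λ c →
    Surjective _≡_ _≡_ c ×
    (∀ u v → (c u ≡ c v → Reach G u v) × (Reach G u v → c u ≡ c v))

-- A set Y is convex exactly when it is closed under completing cycles: if all but one vertex of a
-- cycle lie in Y, so does the last one. A set with fewer than g - 1 elements, g the shortest cycle
-- length, is therefore convex, which gives every lower bound: 2 in general, 3 when both sides are
-- edgeless and the join is bipartite.
--
-- In G₁ ∨ G₂ every cycle stays on one side, so a set is a hull set iff both of its halves are, and
-- the hull numbers add. In G₁ ∧ G₂ the edges across the two sides form triangles with any edge
-- and 4-cycles with any two vertices on each side; closing these, an edge, or two vertices on one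
-- side and one on the other, generate everything.
--
-- When G₁ is a single vertex z, closing the triangles z u v walks through a component from one of
-- its vertices, so z and one vertex per component form a hull set. Conversely z together with all
-- vertices outside one component is convex, so a hull set meets every component; and a set
-- avoiding z and meeting each component at most once is itself convex, so a hull set has a
-- further vertex.

module Submission where

open import Defs
open import Data.Bool using (Bool; true; false; not) renaming (_≟_ to _≟ᵇ_)
open import Data.Bool.Properties using (¬-not; not-involutive)
open import Data.Fin using (Fin; zero; suc; inject₁; fromℕ; splitAt; _↑ˡ_; _↑ʳ_; punchIn; _≟_)
open import Data.Fin.Properties using (suc-injective; ↑ˡ-injective; ↑ʳ-injective; splitAt-↑ˡ; splitAt-↑ʳ; splitAt⁻¹-↑ˡ; splitAt⁻¹-↑ʳ; punchIn-injective; punchInᵢ≢i; any?)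
open import Data.Fin.Relation.Unary.Top using (view; ‵fromℕ; ‵inj₁)
open import Data.Fin.Subset using (Subset; inside; outside; _∈_; _∉_; _⊆_; ∣_∣; ⊥; ⊤; ⁅_⁆; _∪_; _-_)
open import Data.Fin.Subset.Properties using (_∈?_; ∈⊤; x∈⁅x⁆; ∣⊥∣≡0; ∣⁅x⁆∣≡1; p⊆p∪q; q⊆p∪q; x∈p∧x≢y⇒x∈p-y; x∈p⇒∣p-x∣<∣p∣; drop-there)
open import Data.Nat using (ℕ; zero; suc; _+_; _≤_; _<_; z≤n; s≤s; s≤s⁻¹; _≤?_)
open import Data.Nat.Properties using (≤-reflexive; ≤-trans; ≤-antisym; <-≤-trans; ≤⇒≯; ≰⇒>; n≤1+n; +-suc; +-comm; +-monoʳ-≤; +-mono-≤; module ≤-Reasoning)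
open import Data.Product using (∃; ∃₂; _×_; _,_; proj₁; proj₂)
open import Data.Sum using (_⊎_; inj₁; inj₂; [_,_]′)
open import Data.Vec using (Vec; []; _∷_; here; there; _++_; lookup; head; tail; last; tabulate)
import Data.Vec as Vec
open import Data.Vec.Properties using (lookup-++ˡ; lookup-++ʳ; lookup∘tabulate; []=⇒lookup; lookup⇒[]=)
open import Data.Vec.Relation.Unary.All using (All; []; _∷_)
open import Data.Vec.Relation.Unary.All.Properties using (lookup⁺)
open import Data.Vec.Relation.Unary.AllPairs using ([]; _∷_)
open import Data.Vec.Relation.Unary.Linked using (Linked; [-]; _∷_)
open import Data.Vec.Relation.Unary.Unique.Propositional using (Unique)
open import Data.Vec.Relation.Unary.Unique.Propositional.Properties using (lookup-injective)
open import Function using (_∘_; id; const)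
open import Function.Definitions using (Injective)
open import Relation.Binary.PropositionalEquality using (_≡_; _≢_; refl; sym; trans; cong; cong₂; subst; module ≡-Reasoning)
open import Relation.Nullary using (¬_; Dec; yes; no; does; contradiction)
open import Relation.Nullary.Decidable using (_×-dec_; ¬?; dec-true)
open import Relation.Unary using (Pred; Decidable)

private
  variable
    n k : ℕ

∣p∪q∣≤∣p∣+∣q∣ : (p q : Subset n) → ∣ p ∪ q ∣ ≤ ∣ p ∣ + ∣ q ∣
∣p∪q∣≤∣p∣+∣q∣ []            []            = z≤n
∣p∪q∣≤∣p∣+∣q∣ (outside ∷ p) (outside ∷ q) = ∣p∪q∣≤∣p∣+∣q∣ p q
∣p∪q∣≤∣p∣+∣q∣ (inside  ∷ p) (outside ∷ q) = s≤s (∣p∪q∣≤∣p∣+∣q∣ p q)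
∣p∪q∣≤∣p∣+∣q∣ (outside ∷ p) (inside  ∷ q) =
  ≤-trans (s≤s (∣p∪q∣≤∣p∣+∣q∣ p q)) (≤-reflexive (sym (+-suc ∣ p ∣ ∣ q ∣)))
∣p∪q∣≤∣p∣+∣q∣ (inside  ∷ p) (inside  ∷ q) =
  s≤s (≤-trans (∣p∪q∣≤∣p∣+∣q∣ p q) (+-monoʳ-≤ ∣ p ∣ (n≤1+n ∣ q ∣)))

∣p++q∣≡∣p∣+∣q∣ : ∀ {n₁ n₂} (p : Subset n₁) (q : Subset n₂) → ∣ p ++ q ∣ ≡ ∣ p ∣ + ∣ q ∣
∣p++q∣≡∣p∣+∣q∣ []            q = refl
∣p++q∣≡∣p∣+∣q∣ (outside ∷ p) q = ∣p++q∣≡∣p∣+∣q∣ p q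
∣p++q∣≡∣p∣+∣q∣ (inside  ∷ p) q = cong suc (∣p++q∣≡∣p∣+∣q∣ p q)

injective⇒≤∣p∣ : ∀ {p : Subset n} (f : Fin k → Fin n) → Injective _≡_ _≡_ f → (∀ i → f i ∈ p) → k ≤ ∣ p ∣
injective⇒≤∣p∣ {k = zero}  f _ _ = z≤n
injective⇒≤∣p∣ {k = suc k} {p = p} f f-inj f∈p =
  ≤-trans (s≤s (injective⇒≤∣p∣ (f ∘ suc) (suc-injective ∘ f-inj) f∘suc∈p-f₀))
          (x∈p⇒∣p-x∣<∣p∣ (f∈p zero))
  where
  f∘suc∈p-f₀ : ∀ i → f (suc i) ∈ p - f zero
  f∘suc∈p-f₀ i = x∈p∧x≢y⇒x∈p-y (f∈p (suc i)) (λ e → contradiction (f-inj e) λ ())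

image : (Fin k → Fin n) → Subset n
image {k = zero}  f = ⊥
image {k = suc k} f = ⁅ f zero ⁆ ∪ image (f ∘ suc)

∈-image : (f : Fin k → Fin n) → ∀ i → f i ∈ image f
∈-image f zero    = p⊆p∪q (image (f ∘ suc)) (x∈⁅x⁆ (f zero))
∈-image f (suc i) = q⊆p∪q ⁅ f zero ⁆ (image (f ∘ suc)) (∈-image (f ∘ suc) i)

∣image∣≤ : (f : Fin k → Fin n) → ∣ image f ∣ ≤ k
∣image∣≤ {k = zero} {n = n} f = ≤-reflexive (∣⊥∣≡0 n)
∣image∣≤ {k = suc k} f = begin
  ∣ ⁅ f zero ⁆ ∪ image (f ∘ suc) ∣       ≤⟨ ∣p∪q∣≤∣p∣+∣q∣ ⁅ f zero ⁆ (image (f ∘ suc)) ⟩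
  ∣ ⁅ f zero ⁆ ∣ + ∣ image (f ∘ suc) ∣   ≡⟨ cong (_+ ∣ image (f ∘ suc) ∣) (∣⁅x⁆∣≡1 (f zero)) ⟩
  suc ∣ image (f ∘ suc) ∣                ≤⟨ s≤s (∣image∣≤ (f ∘ suc)) ⟩
  suc k                                  ∎
  where open ≤-Reasoning

∣image∣≡ : (f : Fin k → Fin n) → Injective _≡_ _≡_ f → ∣ image f ∣ ≡ k
∣image∣≡ f f-inj = ≤-antisym (∣image∣≤ f) (injective⇒≤∣p∣ f f-inj (∈-image f))

satisfying : ∀ {ℓ} {P : Pred (Fin n) ℓ} → Decidable P → Subset n
satisfying P? = tabulate (λ x → does (P? x))

module _ {ℓ} {P : Pred (Fin n) ℓ} (P? : Decidable P) where

  ∈-satisfying⁺ : ∀ {x} → P x → x ∈ satisfying P?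
  ∈-satisfying⁺ {x} px = lookup⇒[]= x _ (trans (lookup∘tabulate _ x) (dec-true (P? x) px))

  ∈-satisfying⁻ : ∀ {x} → x ∈ satisfying P? → P x
  ∈-satisfying⁻ {x} x∈ with P? x | trans (sym (lookup∘tabulate _ x)) ([]=⇒lookup x∈)
  ... | yes px | _ = px
  ... | no _   | ()

Edge : Graph n → Fin n → Fin n → Set
Edge G u v = adj G u v ≡ true

Irreflexive : Graph n → Set
Irreflexive G = ∀ v → adj G v v ≡ false

edge⇒≢ : ∀ {G : Graph n} → Irreflexive G → ∀ {u v} → Edge G u v → u ≢ v
edge⇒≢ irrefl {u} e refl = contradiction (trans (sym e) (irrefl u)) λ ()

length : ∀ {G : Graph n} → Cycle G → ℕ
length C = 3 + m C

2<length : ∀ {G : Graph n} (C : Cycle G) → 2 < length C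
2<length C = s≤s (s≤s (s≤s z≤n))

linked-lookup : ∀ {a r} {A : Set a} {R : A → A → Set r} {xs : Vec A (suc k)} →
                Linked R xs → ∀ i → R (lookup xs (inject₁ i)) (lookup xs (suc i))
linked-lookup {xs = _ ∷ _ ∷ _} (r ∷ _)  zero    = r
linked-lookup {xs = _ ∷ _ ∷ _} (_ ∷ rs) (suc i) = linked-lookup rs i

lookup-fromℕ : ∀ {a} {A : Set a} (xs : Vec A (suc k)) → lookup xs (fromℕ k) ≡ last xs
lookup-fromℕ (_ ∷ [])          = refl
lookup-fromℕ (_ ∷ xs@(_ ∷ _)) = lookup-fromℕ xs

cycle : ∀ {G : Graph n} {m} (xs : Vec (Fin n) (3 + m)) → Unique xs → Linked (Edge G) xs →
        Edge G (last xs) (head xs) → Cycle G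
cycle {G = G} xs@(x ∷ _) unique linked closing = record
  { m     = _
  ; vs    = lookup xs
  ; inj   = lookup-injective unique _ _
  ; step  = linked-lookup linked
  ; close = subst (λ v → Edge G v x) (sym (lookup-fromℕ xs)) closing
  }

properlyColoured⇒3<length : ∀ {G : Graph n} (colour : Fin n → Bool) →
                            (∀ {u v} → Edge G u v → colour u ≢ colour v) → (C : Cycle G) → 3 < length C
properlyColoured⇒3<length colour proper record { m = suc _ } = s≤s (s≤s (s≤s (s≤s z≤n)))
properlyColoured⇒3<length colour proper record { m = zero ; vs = v ; step = step ; close = close } =
  contradiction (sym colour₀≡colour₂) (proper close)
  where
  open ≡-Reasoning
  colour₀≡colour₂ : colour (v zero) ≡ colour (v (suc (suc zero)))
  colour₀≡colour₂ = begin
    colour (v zero)                           ≡⟨ ¬-not (proper (step zero)) ⟩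
    not (colour (v (suc zero)))               ≡⟨ cong not (¬-not (proper (step (suc zero)))) ⟩
    not (not (colour (v (suc (suc zero)))))   ≡⟨ not-involutive _ ⟩
    colour (v (suc (suc zero)))               ∎

edge-avoiding : ∀ {G : Graph n} (C : Cycle G) i →
                ∃₂ λ j l → j ≢ i × l ≢ i × j ≢ l × Edge G (vs C j) (vs C l)
edge-avoiding C zero          = suc zero , suc (suc zero) , (λ ()) , (λ ()) , (λ ()) , step C (suc zero)
edge-avoiding C (suc zero)    = fromℕ _ , zero , (λ ()) , (λ ()) , (λ ()) , close C
edge-avoiding C (suc (suc _)) = zero , suc zero , (λ ()) , (λ ()) , (λ ()) , step C zero

inject₁²≢suc² : (i : Fin k) → inject₁ (inject₁ i) ≢ suc (suc i)
inject₁²≢suc² (suc i) e = inject₁²≢suc² i (suc-injective e)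

neighbours : ∀ {G : Graph n} (C : Cycle G) i →
             ∃₂ λ j l → j ≢ l × Edge G (vs C j) (vs C i) × Edge G (vs C i) (vs C l)
neighbours C i with view i
... | ‵fromℕ                = inject₁ (fromℕ _) , zero , (λ ()) , step C (fromℕ _) , close C
... | ‵inj₁ {i = zero} _    = fromℕ _ , suc zero , (λ ()) , close C , step C zero
... | ‵inj₁ {i = suc j} _   =
  inject₁ (inject₁ j) , suc (suc j) , inject₁²≢suc² j , step C (inject₁ j) , step C (suc j)

consecutive-constant : ∀ {a} {A : Set a} (g : Fin (suc k) → A) →
                       (∀ i → g (inject₁ i) ≡ g (suc i)) → ∀ i → g i ≡ g zero
consecutive-constant             g g≡ zero    = refl
consecutive-constant {k = suc _} g g≡ (suc i) =
  trans (consecutive-constant (g ∘ suc) (g≡ ∘ suc) i) (sym (g≡ zero))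

CycleClosed : Graph n → Subset n → Set
CycleClosed G Y = ∀ (C : Cycle G) i → (∀ j → j ≢ i → vs C j ∈ Y) → vs C i ∈ Y

module _ {G : Graph n} {Y : Subset n} where

  convex⇒cycleClosed : Convex G Y → CycleClosed G Y
  convex⇒cycleClosed convex C i others with vs C i ∈? Y
  ... | yes vᵢ∈Y = vᵢ∈Y
  ... | no  vᵢ∉Y = convex (vs C i) (inj₂ (C , (i , refl) , vᵢ∉Y , only-i))
    where
    only-i : ∀ j → vs C j ∉ Y → vs C j ≡ vs C i
    only-i j vⱼ∉Y with j ≟ i
    ... | yes refl = refl
    ... | no  j≢i  = contradiction (others j j≢i) vⱼ∉Y

  cycleClosed⇒convex : CycleClosed G Y → Convex G Y
  cycleClosed⇒convex closed x (inj₁ x∈Y) = x∈Y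
  cycleClosed⇒convex closed x (inj₂ (C , (i , refl) , _ , only-i)) = closed C i others
    where
    others : ∀ j → j ≢ i → vs C j ∈ Y
    others j j≢i with vs C j ∈? Y
    ... | yes vⱼ∈Y = vⱼ∈Y
    ... | no  vⱼ∉Y = contradiction (inj C (only-i j vⱼ∉Y)) j≢i

⊤-cycleClosed : ∀ {G : Graph n} → CycleClosed G ⊤
⊤-cycleClosed _ _ _ = ∈⊤

module _ {G : Graph n} {X : Subset n} where

  hullSet⁺ : (∀ Y → CycleClosed G Y → X ⊆ Y → ∀ x → x ∈ Y) → IsHullSet G X
  hullSet⁺ fills x Y convex X⊆Y = fills Y (convex⇒cycleClosed convex) X⊆Y x

  hullSet⁻ : IsHullSet G X → ∀ {Y} → CycleClosed G Y → X ⊆ Y → ∀ x → x ∈ Y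
  hullSet⁻ hull {Y} closed X⊆Y x = hull x Y (cycleClosed⇒convex closed) X⊆Y

cycle-closure : ∀ {G : Graph n} {Y m} → CycleClosed G Y →
                (xs : Vec (Fin n) (3 + m)) → Unique xs → Linked (Edge G) xs →
                Edge G (last xs) (head xs) → All (_∈ Y) (tail xs) → head xs ∈ Y
cycle-closure closed xs@(_ ∷ ys) unique linked closing ys∈Y =
  closed (cycle xs unique linked closing) zero λ where
    zero    0≢0 → contradiction refl 0≢0
    (suc j) _   → lookup⁺ ys∈Y j

others⇒2+m≤∣X∣ : ∀ {G : Graph n} {X} (C : Cycle G) i → (∀ j → j ≢ i → vs C j ∈ X) → 2 + m C ≤ ∣ X ∣
others⇒2+m≤∣X∣ C i others =
  injective⇒≤∣p∣ (vs C ∘ punchIn i) (punchIn-injective i _ _ ∘ inj C)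
                 (λ j → others (punchIn i j) (punchInᵢ≢i i j))

module _ {G : Graph n} (long : ∀ (C : Cycle G) → k < length C) where

  small⇒cycleClosed : ∀ {X} → ∣ X ∣ < k → CycleClosed G X
  small⇒cycleClosed small C i others =
    contradiction (<-≤-trans small (s≤s⁻¹ (long C))) (≤⇒≯ (others⇒2+m≤∣X∣ C i others))

  -- If ∣ X ∣ < k then X is convex, hence all of V(G), which already has k distinct vertices.
  hullSet-size≥ : (xs : Vec (Fin n) k) → Unique xs → ∀ {X} → IsHullSet G X → k ≤ ∣ X ∣
  hullSet-size≥ xs unique {X} hull with k ≤? ∣ X ∣
  ... | yes k≤∣X∣ = k≤∣X∣
  ... | no  k≰∣X∣ = injective⇒≤∣p∣ (lookup xs) (lookup-injective unique _ _)
                      (hullSet⁻ hull (small⇒cycleClosed (≰⇒> k≰∣X∣)) id ∘ lookup xs)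

hullNumber⁺ : ∀ {G : Graph n} (xs : Vec (Fin n) k) → Unique xs →
                (∀ Y → CycleClosed G Y → (∀ i → lookup xs i ∈ Y) → ∀ x → x ∈ Y) →
                (∀ X → IsHullSet G X → k ≤ ∣ X ∣) → IsHullNumber G k
hullNumber⁺ xs unique fills minimal =
  (image (lookup xs) , hullSet⁺ (λ Y closed X⊆Y → fills Y closed (X⊆Y ∘ ∈-image (lookup xs))) ,
   ∣image∣≡ (lookup xs) (lookup-injective unique _ _)) , minimal

record Embedding {n N} (G : Graph n) (H : Graph N) : Set where
  field
    map       : Fin n → Fin N
    injective : Injective _≡_ _≡_ map
    adj-map   : ∀ u v → adj H (map u) (map v) ≡ adj G u v

  cycle⁺ : Cycle G → Cycle H
  cycle⁺ C = record
    { m     = m C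
    ; vs    = map ∘ vs C
    ; inj   = inj C ∘ injective
    ; step  = λ i → trans (adj-map _ _) (step C i)
    ; close = trans (adj-map _ _) (close C)
    }

  cycle⁻ : (C : Cycle H) (g : Fin (length C) → Fin n) → (∀ i → map (g i) ≡ vs C i) → Cycle G
  cycle⁻ C g map∘g≗vs = record
    { m     = m C
    ; vs    = g
    ; inj   = λ e → inj C (trans (sym (map∘g≗vs _)) (trans (cong map e) (map∘g≗vs _)))
    ; step  = λ i → trans (sym (edge-map _ _)) (step C i)
    ; close = trans (sym (edge-map _ _)) (close C)
    }
    where
    edge-map : ∀ i j → adj H (vs C i) (vs C j) ≡ adj G (g i) (g j)
    edge-map i j = trans (cong₂ (adj H) (sym (map∘g≗vs i)) (sym (map∘g≗vs j))) (adj-map _ _)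

  module _ {Y₁ : Subset n} {Y : Subset N}
           (to : ∀ {a} → a ∈ Y₁ → map a ∈ Y) (from : ∀ {a} → map a ∈ Y → a ∈ Y₁) where

    cycleClosed-reflect : CycleClosed H Y → CycleClosed G Y₁
    cycleClosed-reflect closed C i others = from (closed (cycle⁺ C) i (λ j j≢i → to (others j j≢i)))

    cycleClosed-image : CycleClosed G Y₁ → (C : Cycle H) (g : Fin (length C) → Fin n) →
                        (∀ i → map (g i) ≡ vs C i) → ∀ i → (∀ j → j ≢ i → vs C j ∈ Y) → vs C i ∈ Y
    cycleClosed-image closed C g map∘g≗vs i others =
      subst (_∈ Y) (map∘g≗vs i)
        (to (closed (cycle⁻ C g map∘g≗vs) i λ j j≢i →
          from (subst (_∈ Y) (sym (map∘g≗vs j)) (others j j≢i))))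

module Sum (n₁ n₂ : ℕ) where

  ι₁ : Fin n₁ → Fin (n₁ + n₂)
  ι₁ a = a ↑ˡ n₂

  ι₂ : Fin n₂ → Fin (n₁ + n₂)
  ι₂ b = n₁ ↑ʳ b

  data Side : Fin (n₁ + n₂) → Set where
    left  : ∀ a → Side (ι₁ a)
    right : ∀ b → Side (ι₂ b)

  side : ∀ t → Side t
  side t with splitAt n₁ t in eq
  ... | inj₁ a = subst Side (splitAt⁻¹-↑ˡ eq) (left a)
  ... | inj₂ b = subst Side (splitAt⁻¹-↑ʳ eq) (right b)

  ι₁≢ι₂ : ∀ {a b} → ι₁ a ≢ ι₂ b
  ι₁≢ι₂ {a} {b} e =
    contradiction (trans (sym (splitAt-↑ˡ n₁ a n₂)) (trans (cong (splitAt n₁) e) (splitAt-↑ʳ n₁ n₂ b))) λ ()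

  ι₁-≢ : ∀ {a a'} → a ≢ a' → ι₁ a ≢ ι₁ a'
  ι₁-≢ a≢a' = a≢a' ∘ ↑ˡ-injective n₂ _ _

  ι₂-≢ : ∀ {b b'} → b ≢ b' → ι₂ b ≢ ι₂ b'
  ι₂-≢ b≢b' = b≢b' ∘ ↑ʳ-injective n₁ _ _

  all∈ : ∀ {Y} → (∀ a → ι₁ a ∈ Y) → (∀ b → ι₂ b ∈ Y) → ∀ t → t ∈ Y
  all∈ ι₁∈Y ι₂∈Y t with side t
  ... | left a  = ι₁∈Y a
  ... | right b = ι₂∈Y b

  isLeft : Fin (n₁ + n₂) → Bool
  isLeft t = [ const true , const false ]′ (splitAt n₁ t)

  isLeft⇒ι₁ : ∀ t → isLeft t ≡ true → ∃ λ a → ι₁ a ≡ t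
  isLeft⇒ι₁ t _ with splitAt n₁ t in eq
  ... | inj₁ a = a , splitAt⁻¹-↑ˡ eq

  ¬isLeft⇒ι₂ : ∀ t → isLeft t ≡ false → ∃ λ b → ι₂ b ≡ t
  ¬isLeft⇒ι₂ t _ with splitAt n₁ t in eq
  ... | inj₂ b = b , splitAt⁻¹-↑ʳ eq

  module _ (X₁ : Subset n₁) (X₂ : Subset n₂) where

    ∈-++⁺ˡ : ∀ {a} → a ∈ X₁ → ι₁ a ∈ X₁ ++ X₂
    ∈-++⁺ˡ {a} a∈ = lookup⇒[]= _ _ (trans (lookup-++ˡ X₁ X₂ a) ([]=⇒lookup a∈))

    ∈-++⁻ˡ : ∀ {a} → ι₁ a ∈ X₁ ++ X₂ → a ∈ X₁
    ∈-++⁻ˡ {a} a∈ = lookup⇒[]= _ _ (trans (sym (lookup-++ˡ X₁ X₂ a)) ([]=⇒lookup a∈))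

    ∈-++⁺ʳ : ∀ {b} → b ∈ X₂ → ι₂ b ∈ X₁ ++ X₂
    ∈-++⁺ʳ {b} b∈ = lookup⇒[]= _ _ (trans (lookup-++ʳ X₁ X₂ b) ([]=⇒lookup b∈))

    ∈-++⁻ʳ : ∀ {b} → ι₂ b ∈ X₁ ++ X₂ → b ∈ X₂
    ∈-++⁻ʳ {b} b∈ = lookup⇒[]= _ _ (trans (sym (lookup-++ʳ X₁ X₂ b)) ([]=⇒lookup b∈))

  ++-⊆ : ∀ {X₁ Y₁ : Subset n₁} {X₂ Y₂ : Subset n₂} → X₁ ⊆ Y₁ → X₂ ⊆ Y₂ → X₁ ++ X₂ ⊆ Y₁ ++ Y₂
  ++-⊆ {X₁} {Y₁} {X₂} {Y₂} X₁⊆Y₁ X₂⊆Y₂ {t} t∈ with side t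
  ... | left a  = ∈-++⁺ˡ Y₁ Y₂ (X₁⊆Y₁ (∈-++⁻ˡ X₁ X₂ t∈))
  ... | right b = ∈-++⁺ʳ Y₁ Y₂ (X₂⊆Y₂ (∈-++⁻ʳ X₁ X₂ t∈))

open Embedding using (cycleClosed-reflect; cycleClosed-image)

module Union {n₁ n₂} (G₁ : Graph n₁) (G₂ : Graph n₂) where
  open Sum n₁ n₂

  U : Graph (n₁ + n₂)
  U = G₁ ∨ᴳ G₂

  embed₁ : Embedding G₁ U
  embed₁ = record
    { map       = ι₁
    ; injective = ↑ˡ-injective n₂ _ _
    ; adj-map   = λ a a' → cong₂ (unionAdj G₁ G₂) (splitAt-↑ˡ n₁ a n₂) (splitAt-↑ˡ n₁ a' n₂)
    }

  embed₂ : Embedding G₂ U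
  embed₂ = record
    { map       = ι₂
    ; injective = ↑ʳ-injective n₁ _ _
    ; adj-map   = λ b b' → cong₂ (unionAdj G₁ G₂) (splitAt-↑ʳ n₁ n₂ b) (splitAt-↑ʳ n₁ n₂ b')
    }

  edge-isLeft : ∀ {u v} → Edge U u v → isLeft u ≡ isLeft v
  edge-isLeft {u} {v} = sameSide (splitAt n₁ u) (splitAt n₁ v)
    where
    sameSide : ∀ s s' → unionAdj G₁ G₂ s s' ≡ true →
               [ const true , const false ]′ s ≡ [ const true , const false ]′ s'
    sameSide (inj₁ _) (inj₁ _) _ = refl
    sameSide (inj₂ _) (inj₂ _) _ = refl

  cycle-isLeft : (C : Cycle U) → ∀ i j → isLeft (vs C i) ≡ isLeft (vs C j)
  cycle-isLeft C i j = trans (constant i) (sym (constant j))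
    where
    constant : ∀ k → isLeft (vs C k) ≡ isLeft (vs C zero)
    constant = consecutive-constant (isLeft ∘ vs C) (edge-isLeft ∘ step C)

  cycleClosed-++ : ∀ {Y₁ Y₂} → CycleClosed G₁ Y₁ → CycleClosed G₂ Y₂ → CycleClosed U (Y₁ ++ Y₂)
  cycleClosed-++ {Y₁} {Y₂} closed₁ closed₂ C i with isLeft (vs C i) in isLeftᵢ
  ... | true  =
    cycleClosed-image embed₁ (∈-++⁺ˡ Y₁ Y₂) (∈-++⁻ˡ Y₁ Y₂) closed₁ C (proj₁ ∘ onLeft) (proj₂ ∘ onLeft) i
    where
    onLeft : ∀ j → ∃ λ a → ι₁ a ≡ vs C j
    onLeft j = isLeft⇒ι₁ (vs C j) (trans (cycle-isLeft C j i) isLeftᵢ)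
  ... | false =
    cycleClosed-image embed₂ (∈-++⁺ʳ Y₁ Y₂) (∈-++⁻ʳ Y₁ Y₂) closed₂ C (proj₁ ∘ onRight) (proj₂ ∘ onRight) i
    where
    onRight : ∀ j → ∃ λ b → ι₂ b ≡ vs C j
    onRight j = ¬isLeft⇒ι₂ (vs C j) (trans (cycle-isLeft C j i) isLeftᵢ)

  hullSet-++⁺ : ∀ {X₁ X₂} → IsHullSet G₁ X₁ → IsHullSet G₂ X₂ → IsHullSet U (X₁ ++ X₂)
  hullSet-++⁺ {X₁} {X₂} hull₁ hull₂ = hullSet⁺ λ Y closed X⊆Y → fill Y closed X⊆Y (Vec.splitAt n₁ Y)
    where
    fill : ∀ Y → CycleClosed U Y → X₁ ++ X₂ ⊆ Y → (∃₂ λ Y₁ Y₂ → Y ≡ Y₁ ++ Y₂) → ∀ t → t ∈ Y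
    fill _ closed X⊆Y (Y₁ , Y₂ , refl) = all∈
      (∈-++⁺ˡ Y₁ Y₂ ∘ hullSet⁻ hull₁ (cycleClosed-reflect embed₁ (∈-++⁺ˡ Y₁ Y₂) (∈-++⁻ˡ Y₁ Y₂) closed)
                                    (∈-++⁻ˡ Y₁ Y₂ ∘ X⊆Y ∘ ∈-++⁺ˡ X₁ X₂))
      (∈-++⁺ʳ Y₁ Y₂ ∘ hullSet⁻ hull₂ (cycleClosed-reflect embed₂ (∈-++⁺ʳ Y₁ Y₂) (∈-++⁻ʳ Y₁ Y₂) closed)
                                    (∈-++⁻ʳ Y₁ Y₂ ∘ X⊆Y ∘ ∈-++⁺ʳ X₁ X₂))

  hullSet-++⁻ˡ : ∀ X₁ X₂ → IsHullSet U (X₁ ++ X₂) → IsHullSet G₁ X₁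
  hullSet-++⁻ˡ X₁ X₂ hull = hullSet⁺ λ Y₁ closed₁ X₁⊆Y₁ a →
    ∈-++⁻ˡ Y₁ ⊤ (hullSet⁻ hull (cycleClosed-++ closed₁ ⊤-cycleClosed) (++-⊆ X₁⊆Y₁ (const ∈⊤)) (ι₁ a))

  hullSet-++⁻ʳ : ∀ X₁ X₂ → IsHullSet U (X₁ ++ X₂) → IsHullSet G₂ X₂
  hullSet-++⁻ʳ X₁ X₂ hull = hullSet⁺ λ Y₂ closed₂ X₂⊆Y₂ b →
    ∈-++⁻ʳ ⊤ Y₂ (hullSet⁻ hull (cycleClosed-++ ⊤-cycleClosed closed₂) (++-⊆ (const ∈⊤) X₂⊆Y₂) (ι₂ b))

  hullNumber : ∀ {h₁ h₂} → IsHullNumber G₁ h₁ → IsHullNumber G₂ h₂ → IsHullNumber U (h₁ + h₂)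
  hullNumber {h₁} {h₂} ((X₁ , hull₁ , ∣X₁∣≡h₁) , minimal₁) ((X₂ , hull₂ , ∣X₂∣≡h₂) , minimal₂) =
    (X₁ ++ X₂ , hullSet-++⁺ hull₁ hull₂ , trans (∣p++q∣≡∣p∣+∣q∣ X₁ X₂) (cong₂ _+_ ∣X₁∣≡h₁ ∣X₂∣≡h₂)) ,
    λ X hull → minimal X hull (Vec.splitAt n₁ X)
    where
    minimal : ∀ X → IsHullSet U X → (∃₂ λ Y₁ Y₂ → X ≡ Y₁ ++ Y₂) → h₁ + h₂ ≤ ∣ X ∣
    minimal _ hull (Y₁ , Y₂ , refl) =
      subst (h₁ + h₂ ≤_) (sym (∣p++q∣≡∣p∣+∣q∣ Y₁ Y₂))
        (+-mono-≤ (minimal₁ Y₁ (hullSet-++⁻ˡ Y₁ Y₂ hull)) (minimal₂ Y₂ (hullSet-++⁻ʳ Y₁ Y₂ hull)))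

two-distinct : 2 ≤ n → ∃₂ λ (a a' : Fin n) → a ≢ a'
two-distinct (s≤s (s≤s _)) = zero , suc zero , λ ()

edge-or-edgeless : (G : Graph n) → (∃₂ λ u v → Edge G u v) ⊎ NoEdges G
edge-or-edgeless G with any? (λ u → any? (λ v → adj G u v ≟ᵇ true))
... | yes (u , v , e) = inj₁ (u , v , e)
... | no  none        = inj₂ λ u v → ¬-not λ e → none (u , v , e)

module Join {n₁ n₂} (G₁ : Graph n₁) (G₂ : Graph n₂) where
  open Sum n₁ n₂

  J : Graph (n₁ + n₂)
  J = G₁ ∧ᴳ G₂

  edge-ι₁ι₂ : ∀ {a b} → Edge J (ι₁ a) (ι₂ b)
  edge-ι₁ι₂ {a} {b} = cong₂ (joinAdj G₁ G₂) (splitAt-↑ˡ n₁ a n₂) (splitAt-↑ʳ n₁ n₂ b)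

  edge-ι₂ι₁ : ∀ {a b} → Edge J (ι₂ b) (ι₁ a)
  edge-ι₂ι₁ {a} {b} = cong₂ (joinAdj G₁ G₂) (splitAt-↑ʳ n₁ n₂ b) (splitAt-↑ˡ n₁ a n₂)

  edge-ι₁ι₁ : ∀ {a a'} → Edge G₁ a a' → Edge J (ι₁ a) (ι₁ a')
  edge-ι₁ι₁ {a} {a'} = trans (cong₂ (joinAdj G₁ G₂) (splitAt-↑ˡ n₁ a n₂) (splitAt-↑ˡ n₁ a' n₂))

  edge-ι₂ι₂ : ∀ {b b'} → Edge G₂ b b' → Edge J (ι₂ b) (ι₂ b')
  edge-ι₂ι₂ {b} {b'} = trans (cong₂ (joinAdj G₁ G₂) (splitAt-↑ʳ n₁ n₂ b) (splitAt-↑ʳ n₁ n₂ b'))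

  module _ {Y} (closed : CycleClosed J Y) where

    triangle-ι₂ : ∀ {a a'} → a ≢ a' → Edge G₁ a a' → ι₁ a ∈ Y → ι₁ a' ∈ Y → ∀ b → ι₂ b ∈ Y
    triangle-ι₂ {a} {a'} a≢a' e a∈ a'∈ b = cycle-closure closed (ι₂ b ∷ ι₁ a ∷ ι₁ a' ∷ [])
      ((ι₁≢ι₂ ∘ sym ∷ ι₁≢ι₂ ∘ sym ∷ []) ∷ (ι₁-≢ a≢a' ∷ []) ∷ [] ∷ [])
      (edge-ι₂ι₁ ∷ edge-ι₁ι₁ e ∷ [-]) edge-ι₁ι₂ (a∈ ∷ a'∈ ∷ [])

    triangle-ι₁ : ∀ {b b'} → b ≢ b' → Edge G₂ b b' → ι₂ b ∈ Y → ι₂ b' ∈ Y → ∀ a → ι₁ a ∈ Y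
    triangle-ι₁ {b} {b'} b≢b' e b∈ b'∈ a = cycle-closure closed (ι₁ a ∷ ι₂ b ∷ ι₂ b' ∷ [])
      ((ι₁≢ι₂ ∷ ι₁≢ι₂ ∷ []) ∷ (ι₂-≢ b≢b' ∷ []) ∷ [] ∷ [])
      (edge-ι₁ι₂ ∷ edge-ι₂ι₂ e ∷ [-]) edge-ι₂ι₁ (b∈ ∷ b'∈ ∷ [])

    square-ι₂ : ∀ {a a' b} → a ≢ a' → ι₁ a ∈ Y → ι₁ a' ∈ Y → ι₂ b ∈ Y → ∀ b' → ι₂ b' ∈ Y
    square-ι₂ {a} {a'} {b} a≢a' a∈ a'∈ b∈ b' with b' ≟ b
    ... | yes refl = b∈
    ... | no  b'≢b = cycle-closure closed (ι₂ b' ∷ ι₁ a ∷ ι₂ b ∷ ι₁ a' ∷ [])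
      ((ι₁≢ι₂ ∘ sym ∷ ι₂-≢ b'≢b ∷ ι₁≢ι₂ ∘ sym ∷ []) ∷ (ι₁≢ι₂ ∷ ι₁-≢ a≢a' ∷ []) ∷ (ι₁≢ι₂ ∘ sym ∷ []) ∷ [] ∷ [])
      (edge-ι₂ι₁ ∷ edge-ι₁ι₂ ∷ edge-ι₂ι₁ ∷ [-]) edge-ι₁ι₂ (a∈ ∷ b∈ ∷ a'∈ ∷ [])

    square-ι₁ : ∀ {b b' a} → b ≢ b' → ι₂ b ∈ Y → ι₂ b' ∈ Y → ι₁ a ∈ Y → ∀ a' → ι₁ a' ∈ Y
    square-ι₁ {b} {b'} {a} b≢b' b∈ b'∈ a∈ a' with a' ≟ a
    ... | yes refl = a∈
    ... | no  a'≢a = cycle-closure closed (ι₁ a' ∷ ι₂ b ∷ ι₁ a ∷ ι₂ b' ∷ [])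
      ((ι₁≢ι₂ ∷ ι₁-≢ a'≢a ∷ ι₁≢ι₂ ∷ []) ∷ (ι₁≢ι₂ ∘ sym ∷ ι₂-≢ b≢b' ∷ []) ∷ (ι₁≢ι₂ ∷ []) ∷ [] ∷ [])
      (edge-ι₁ι₂ ∷ edge-ι₂ι₁ ∷ edge-ι₁ι₂ ∷ [-]) edge-ι₂ι₁ (b∈ ∷ a∈ ∷ b'∈ ∷ [])

  hullNumber-edge₁ : ∀ {b₀ b₁ a a'} → b₀ ≢ b₁ → a ≢ a' → Edge G₁ a a' → IsHullNumber J 2
  hullNumber-edge₁ {b₀} {b₁} {a} {a'} b₀≢b₁ a≢a' e =
    hullNumber⁺ (ι₁ a ∷ ι₁ a' ∷ []) unique
      (λ Y closed xs∈Y →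
        let ι₂∈Y = triangle-ι₂ closed a≢a' e (xs∈Y zero) (xs∈Y (suc zero))
        in  all∈ (square-ι₁ closed b₀≢b₁ (ι₂∈Y b₀) (ι₂∈Y b₁) (xs∈Y zero)) ι₂∈Y)
      (λ _ → hullSet-size≥ 2<length (ι₁ a ∷ ι₁ a' ∷ []) unique)
    where
    unique : Unique (ι₁ a ∷ ι₁ a' ∷ [])
    unique = (ι₁-≢ a≢a' ∷ []) ∷ [] ∷ []

  hullNumber-edge₂ : ∀ {a₀ a₁ b b'} → a₀ ≢ a₁ → b ≢ b' → Edge G₂ b b' → IsHullNumber J 2
  hullNumber-edge₂ {a₀} {a₁} {b} {b'} a₀≢a₁ b≢b' e =
    hullNumber⁺ (ι₂ b ∷ ι₂ b' ∷ []) unique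
      (λ Y closed xs∈Y →
        let ι₁∈Y = triangle-ι₁ closed b≢b' e (xs∈Y zero) (xs∈Y (suc zero))
        in  all∈ ι₁∈Y (square-ι₂ closed a₀≢a₁ (ι₁∈Y a₀) (ι₁∈Y a₁) (xs∈Y zero)))
      (λ _ → hullSet-size≥ 2<length (ι₂ b ∷ ι₂ b' ∷ []) unique)
    where
    unique : Unique (ι₂ b ∷ ι₂ b' ∷ [])
    unique = (ι₂-≢ b≢b' ∷ []) ∷ [] ∷ []

  hullNumber-nonEdgeless : 2 ≤ n₁ → 2 ≤ n₂ → Irreflexive G₁ → Irreflexive G₂ →
                           ¬ (NoEdges G₁ × NoEdges G₂) → IsHullNumber J 2
  hullNumber-nonEdgeless 2≤n₁ 2≤n₂ irrefl₁ irrefl₂ not-edgeless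
    with two-distinct 2≤n₁ | two-distinct 2≤n₂ | edge-or-edgeless G₁ | edge-or-edgeless G₂
  ... | _ , _ , _     | _ , _ , b₀≢b₁ | inj₁ (_ , _ , e) | _                =
    hullNumber-edge₁ b₀≢b₁ (edge⇒≢ irrefl₁ e) e
  ... | _ , _ , a₀≢a₁ | _ , _ , _     | inj₂ _           | inj₁ (_ , _ , e) =
    hullNumber-edge₂ a₀≢a₁ (edge⇒≢ irrefl₂ e) e
  ... | _             | _             | inj₂ edgeless₁   | inj₂ edgeless₂   =
    contradiction (edgeless₁ , edgeless₂) not-edgeless

  hullNumber-edgeless : 2 ≤ n₁ → 2 ≤ n₂ → NoEdges G₁ → NoEdges G₂ → IsHullNumber J 3
  hullNumber-edgeless 2≤n₁ 2≤n₂ edgeless₁ edgeless₂ with two-distinct 2≤n₁ | two-distinct 2≤n₂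
  ... | a₀ , a₁ , a₀≢a₁ | b₀ , b₁ , b₀≢b₁ =
    hullNumber⁺ (ι₁ a₀ ∷ ι₁ a₁ ∷ ι₂ b₀ ∷ []) unique
      (λ Y closed xs∈Y →
        let ι₂∈Y = square-ι₂ closed a₀≢a₁ (xs∈Y zero) (xs∈Y (suc zero)) (xs∈Y (suc (suc zero)))
        in  all∈ (square-ι₁ closed b₀≢b₁ (ι₂∈Y b₀) (ι₂∈Y b₁) (xs∈Y zero)) ι₂∈Y)
      (λ _ → hullSet-size≥ (properlyColoured⇒3<length isLeft sides-alternate)
                           (ι₁ a₀ ∷ ι₁ a₁ ∷ ι₂ b₀ ∷ []) unique)
    where
    unique : Unique (ι₁ a₀ ∷ ι₁ a₁ ∷ ι₂ b₀ ∷ [])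
    unique = (ι₁-≢ a₀≢a₁ ∷ ι₁≢ι₂ ∷ []) ∷ (ι₁≢ι₂ ∷ []) ∷ [] ∷ []

    sides-alternate : ∀ {u v} → Edge J u v → isLeft u ≢ isLeft v
    sides-alternate {u} {v} = otherSide (splitAt n₁ u) (splitAt n₁ v)
      where
      otherSide : ∀ s s' → joinAdj G₁ G₂ s s' ≡ true →
                  [ const true , const false ]′ s ≢ [ const true , const false ]′ s'
      otherSide (inj₁ a) (inj₁ a') e _ = contradiction (trans (sym e) (edgeless₁ a a')) λ ()
      otherSide (inj₂ b) (inj₂ b') e _ = contradiction (trans (sym e) (edgeless₂ b b')) λ ()
      otherSide (inj₁ _) (inj₂ _)  _ ()
      otherSide (inj₂ _) (inj₁ _)  _ ()

module Components {n p} (G : Graph n) (components : NumComponents G p) where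

  component : Fin n → Fin p
  component = proj₁ components

  rep : Fin p → Fin n
  rep k = proj₁ (proj₁ (proj₂ components) k)

  component-rep : ∀ k → component (rep k) ≡ k
  component-rep k = proj₂ (proj₁ (proj₂ components) k) refl

  rep-injective : Injective _≡_ _≡_ rep
  rep-injective {k} {k'} e = trans (sym (component-rep k)) (trans (cong component e) (component-rep k'))

  same⇒reach : ∀ {u v} → component u ≡ component v → Reach G u v
  same⇒reach = proj₁ (proj₂ (proj₂ components) _ _)

  edge⇒same : ∀ {u v} → Edge G u v → component u ≡ component v
  edge⇒same e = proj₂ (proj₂ (proj₂ components) _ _) (there e here)

  MeetsAll : Subset n → Set
  MeetsAll W = ∀ k → ∃ λ u → u ∈ W × component u ≡ k

  SharesComponent : Subset n → Set
  SharesComponent W = ∃₂ λ u v → u ≢ v × u ∈ W × v ∈ W × component u ≡ component v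

  sharesComponent? : ∀ W → Dec (SharesComponent W)
  sharesComponent? W = any? λ u → any? λ v →
    ¬? (u ≟ v) ×-dec (u ∈? W) ×-dec (v ∈? W) ×-dec (component u ≟ component v)

  meetsAll⇒p≤∣W∣ : ∀ {W} → MeetsAll W → p ≤ ∣ W ∣
  meetsAll⇒p≤∣W∣ meets = injective⇒≤∣p∣ (proj₁ ∘ meets) injective (proj₁ ∘ proj₂ ∘ meets)
    where
    injective : Injective _≡_ _≡_ (proj₁ ∘ meets)
    injective {k} {k'} e =
      trans (sym (proj₂ (proj₂ (meets k)))) (trans (cong component e) (proj₂ (proj₂ (meets k'))))

  -- Removing one of two vertices sharing a component still meets every component.
  meetsAll⇒p<∣W∣ : ∀ {W} → MeetsAll W → SharesComponent W → p < ∣ W ∣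
  meetsAll⇒p<∣W∣ {W} meets (u , v , u≢v , u∈W , v∈W , cu≡cv) =
    <-≤-trans (s≤s (meetsAll⇒p≤∣W∣ meets-W-u)) (x∈p⇒∣p-x∣<∣p∣ u∈W)
    where
    meets-W-u : MeetsAll (W - u)
    meets-W-u k with component u ≟ k
    ... | yes cu≡k = v , x∈p∧x≢y⇒x∈p-y v∈W (u≢v ∘ sym) , trans (sym cu≡cv) cu≡k
    ... | no  cu≢k = let (w , w∈W , cw≡k) = meets k in
                     w , x∈p∧x≢y⇒x∈p-y w∈W (λ { refl → cu≢k cw≡k }) , cw≡k

-- The join with a single vertex: the apex is zero and the vertex b of G becomes suc b.
module Cone {n p} (G₀ : Graph 1) (G : Graph n) (irrefl : Irreflexive G)
            (components : NumComponents G p) where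
  open Components G components

  K : Graph (suc n)
  K = G₀ ∧ᴳ G

  module _ {Y} (closed : CycleClosed K Y) (apex∈Y : zero ∈ Y) where

    edge-closure : ∀ {u v} → Edge G u v → suc u ∈ Y → suc v ∈ Y
    edge-closure {u} {v} e u∈Y = cycle-closure closed (suc v ∷ zero ∷ suc u ∷ [])
      (((λ ()) ∷ (λ v≡u → edge⇒≢ irrefl e (sym (suc-injective v≡u))) ∷ []) ∷ ((λ ()) ∷ []) ∷ [] ∷ [])
      (refl ∷ refl ∷ [-]) e (apex∈Y ∷ u∈Y ∷ [])

    reach-closure : ∀ {u v} → Reach G u v → suc u ∈ Y → suc v ∈ Y
    reach-closure here        u∈Y = u∈Y
    reach-closure (there e r) u∈Y = reach-closure r (edge-closure e u∈Y)

  apexAndReps-hullSet : IsHullSet K (inside ∷ image rep)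
  apexAndReps-hullSet = hullSet⁺ λ Y closed X⊆Y → λ where
    zero    → X⊆Y here
    (suc b) → reach-closure closed (X⊆Y here) (same⇒reach (component-rep (component b)))
                                   (X⊆Y (there (∈-image rep (component b))))

  outside? : ∀ k u → Dec (component u ≢ k)
  outside? k u = ¬? (component u ≟ k)

  avoiding : Fin p → Subset (suc n)
  avoiding k = inside ∷ satisfying (outside? k)

  loopless : ∀ {b} → ¬ Edge K (suc b) (suc b)
  loopless e = edge⇒≢ {G = G} irrefl e refl

  -- A vertex of component k whose cycle-neighbours both avoid component k has the apex as
  -- both neighbours, which is impossible on a cycle.
  lone-vertex : ∀ k (C : Cycle K) i {b} → vs C i ≡ suc b → component b ≡ k →
                ¬ (∀ j → j ≢ i → vs C j ∈ avoiding k)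
  lone-vertex k C i {b} vᵢ≡ cb≡k others with neighbours C i
  ... | j , l , j≢l , eⱼ , eₗ =
    j≢l (inj C (trans (apex (others j j≢i) (inj₁ eⱼ')) (sym (apex (others l l≢i) (inj₂ eₗ')))))
    where
    eⱼ' : Edge K (vs C j) (suc b)
    eⱼ' = subst (Edge K (vs C j)) vᵢ≡ eⱼ
    eₗ' : Edge K (suc b) (vs C l)
    eₗ' = subst (λ t → Edge K t (vs C l)) vᵢ≡ eₗ
    j≢i : j ≢ i
    j≢i refl = loopless (subst (λ t → Edge K t (suc b)) vᵢ≡ eⱼ')
    l≢i : l ≢ i
    l≢i refl = loopless (subst (Edge K (suc b)) vᵢ≡ eₗ')
    apex : ∀ {t} → t ∈ avoiding k → Edge K t (suc b) ⊎ Edge K (suc b) t → t ≡ zero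
    apex {zero}  _  _ = refl
    apex {suc u} u∈ e = contradiction (trans ([ edge⇒same , sym ∘ edge⇒same ]′ e) cb≡k)
                                      (∈-satisfying⁻ (outside? k) (drop-there u∈))

  avoiding-closed : ∀ k → CycleClosed K (avoiding k)
  avoiding-closed k C i others with vs C i in vᵢ≡
  ... | zero  = here
  ... | suc b with component b ≟ k
  ...   | no  cb≢k = there (∈-satisfying⁺ (outside? k) cb≢k)
  ...   | yes cb≡k = contradiction others (lone-vertex k C i vᵢ≡ cb≡k)

  hullSet⇒meetsAll : ∀ {x W} → IsHullSet K (x ∷ W) → MeetsAll W
  hullSet⇒meetsAll {x} {W} hull k with any? (λ u → (u ∈? W) ×-dec (component u ≟ k))
  ... | yes meets = meets
  ... | no  misses =
    contradiction (component-rep k)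
      (∈-satisfying⁻ (outside? k) (drop-there (hullSet⁻ hull (avoiding-closed k) x∷W⊆ (suc (rep k)))))
    where
    x∷W⊆ : x ∷ W ⊆ avoiding k
    x∷W⊆ {zero}  _           = here
    x∷W⊆ {suc u} (there u∈W) = there (∈-satisfying⁺ (outside? k) λ cu≡k → misses (u , u∈W , cu≡k))

  -- Some edge of the cycle avoids position i; its ends would be two vertices of W in one component.
  apart-closed : ∀ {W} → ¬ SharesComponent W → CycleClosed K (outside ∷ W)
  apart-closed {W} apart C i others with edge-avoiding C i
  ... | j , l , j≢i , l≢i , j≢l , e with vs C j in vⱼ≡ | vs C l in vₗ≡ | others j j≢i | others l l≢i
  ...   | suc u | suc v | there u∈W | there v∈W =
    contradiction (u , v , u≢v , u∈W , v∈W , edge⇒same e) apart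
    where
    u≢v : u ≢ v
    u≢v refl = j≢l (inj C (trans vⱼ≡ (sym vₗ≡)))

  hullSet-size : ∀ {X} → IsHullSet K X → suc p ≤ ∣ X ∣
  hullSet-size {inside ∷ W} hull = s≤s (meetsAll⇒p≤∣W∣ (hullSet⇒meetsAll hull))
  hullSet-size {outside ∷ W} hull with sharesComponent? W
  ... | yes shares = meetsAll⇒p<∣W∣ (hullSet⇒meetsAll hull) shares
  ... | no  apart  = contradiction (hullSet⁻ hull (apart-closed apart) id zero) λ ()

  hullNumber : IsHullNumber K (suc p)
  hullNumber = (inside ∷ image rep , apexAndReps-hullSet , cong suc (∣image∣≡ rep rep-injective)) ,
               λ _ → hullSet-size

lemma6 : ∀ {n₁ n₂ : ℕ} (G₁ : Graph n₁) (G₂ : Graph n₂) →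
    IsSimple G₁ → IsSimple G₂ → 1 ≤ n₁ → n₁ ≤ n₂ →
    ∀ (p h₁ h₂ : ℕ) → NumComponents G₂ p →
    IsHullNumber G₁ h₁ → IsHullNumber G₂ h₂ →
    IsHullNumber (G₁ ∨ᴳ G₂) (h₁ + h₂) ×
    (n₁ ≡ 1 → IsHullNumber (G₁ ∧ᴳ G₂) (p + 1)) ×
    (1 < n₁ → ¬ (NoEdges G₁ × NoEdges G₂) → IsHullNumber (G₁ ∧ᴳ G₂) 2) ×
    (1 < n₁ → NoEdges G₁ → NoEdges G₂ → IsHullNumber (G₁ ∧ᴳ G₂) 3)
lemma6 G₁ G₂ simple₁ simple₂ _ n₁≤n₂ p h₁ h₂ components hn₁ hn₂ =
  Union.hullNumber G₁ G₂ hn₁ hn₂ ,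
  (λ { refl → subst (IsHullNumber _) (+-comm 1 p)
                 (Cone.hullNumber G₁ G₂ (IsSimple.irrefl simple₂) components) }) ,
  (λ 2≤n₁ → Join.hullNumber-nonEdgeless G₁ G₂ 2≤n₁ (≤-trans 2≤n₁ n₁≤n₂)
              (IsSimple.irrefl simple₁) (IsSimple.irrefl simple₂)) ,
  (λ 2≤n₁ → Join.hullNumber-edgeless G₁ G₂ 2≤n₁ (≤-trans 2≤n₁ n₁≤n₂))
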